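{- Let $\mathbb{X}=\langle X,\{\rho_i:i\in I\}\rangle$ be a relational structure and let $\mathbb{P}(\mathbb{X})=\{A\subseteq X:\langle A,\{\rho_i\cap A^{n_i}:i\in I\}\rangle\cong\mathbb{X}\}$, where $n_i$ is the arity of $\rho_i$. Then: (a) $\langle \mathbb{P}(\mathbb{X}),\subseteq\rangle$ is a homogeneous poset; (b) $\langle \mathbb{P}(\mathbb{X}),\subseteq\rangle$ is either atomless or atomic; (c) $\langle \mathbb{P}(\mathbb{X}),\subseteq\rangle$ is atomless if and only if it contains two incompatible elements; (d) if $\langle \mathbb{P}(\mathbb{X}),\subseteq\rangle$ is atomic, then $\mathrm{At}(\mathbb{P}(\mathbb{X}))=\mathbb{P}(\mathbb{X})$ and $\mathbb{P}(\mathbb{X})$ is a uniform filter base on $X$; moreover $\bigcap\mathbb{P}(\mathbb{X})\in\mathbb{P}(\mathbb{X})$ if and only if $\mathbb{P}(\mathbb{X})=\{X\}$.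
   Context: Equivalently $\mathbb{P}(\mathbb{X})=\{f[X]: f \text{ an embedding of }\mathbb{X}\text{ into itself}\}$. For a poset $\mathbb{P}=\langle P,\le\rangle$: $p,q$ are compatible iff there is $r\le p,q$, otherwise incompatible; $p$ is an atom ($p\in\mathrm{At}(\mathbb{P})$) iff any two $q,r\le p$ are compatible; $\mathbb{P}$ is atomless iff $\mathrm{At}(\mathbb{P})=\emptyset$, atomic iff $\mathrm{At}(\mathbb{P})$ is dense in $\mathbb{P}$; $\mathbb{P}$ is homogeneous iff it has a largest element and $\mathbb{P}\cong(-\infty,p]_{\mathbb{P}}$ for every $p\in P$. A family $\mathcal{B}$ is a uniform filter base on $X$ iff $\emptyset\neq\mathcal{B}\subseteq[X]^{|X|}$ and for all $A,B\in\mathcal{B}$ there is $C\in\mathcal{B}$ with $C\subseteq A\cap B$. -}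

module Defs where

import Level
open import Level using (0ℓ) renaming (suc to lsuc)
open import Data.Nat using (ℕ)
open import Data.Bool using (Bool; true; false; T)
open import Data.Vec using (Vec) renaming (map to vmap)
open import Data.Product using (Σ; ∃; ∃-syntax; _×_; _,_; proj₁; proj₂)
open import Function using (_∘_; id)
open import Function.Bundles using (_↔_; _⇔_; Inverse)
open import Relation.Nullary using (¬_)
open import Relation.Binary.Bundles using (Poset)
open import Relation.Binary.Morphism.Structures using (IsOrderIsomorphism)

record RelStr : Set₁ where
  field
    Carrier : Set
    Index   : Set
    arity   : Index → ℕ
    rel     : (i : Index) → Vec Carrier (arity i) → Set

-- Subsets of a set (classically every subset is given by its
-- characteristic function; membership is then proof-irrelevant)

Subset : Set → Set
Subset X = X → Bool

module _ {X : Set} where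

  _∈_ : X → Subset X → Set
  x ∈ A = T (A x)

  _⊆_ : Subset X → Subset X → Set
  A ⊆ B = ∀ x → x ∈ A → x ∈ B

  _≐_ : Subset X → Subset X → Set
  A ≐ B = (A ⊆ B) × (B ⊆ A)

  full : Subset X
  full _ = true

  Elem : Subset X → Set
  Elem A = Σ X (λ x → x ∈ A)

-- P(𝕏): subsets A with ⟨A, {ρᵢ ∩ Aⁿⁱ}⟩ ≅ 𝕏.
-- An isomorphism is a bijection h : A → X such that for every i and
-- every tuple v from A:  v ∈ ρᵢ ∩ Aⁿⁱ  ⇔  h(v) ∈ ρᵢ.

module _ (𝕏 : RelStr) where
  open RelStr 𝕏

  IsCopy : Subset Carrier → Set
  IsCopy A =
    Σ (Elem A ↔ Carrier) λ h →
      ∀ (i : Index) (v : Vec (Elem A) (arity i)) →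
        rel i (vmap proj₁ v) ⇔ rel i (vmap (Inverse.to h) v)

  Copy : Set
  Copy = Σ (Subset Carrier) IsCopy

  ℙ : Poset 0ℓ 0ℓ 0ℓ
  ℙ = record
    { Carrier = Copy
    ; _≈_ = λ A B → proj₁ A ≐ proj₁ B
    ; _≤_ = λ A B → proj₁ A ⊆ proj₁ B
    ; isPartialOrder = record
      { isPreorder = record
        { isEquivalence = record
          { refl = (λ x p → p) , (λ x p → p)
          ; sym = λ (p , q) → q , p
          ; trans = λ (p , q) (r , s) → (λ x → r x ∘ p x) , (λ x → q x ∘ s x)
          }
        ; reflexive = proj₁
        ; trans = λ p q x → q x ∘ p x
        }
      ; antisym = _,_
      }
    }

  -- uniform filter base on X:  ∅ ≠ ℬ ⊆ [X]^|X|  and ℬ is downward directed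
  IsUniformFilterBase : (Subset Carrier → Set) → Set
  IsUniformFilterBase ℬ =
    (∃[ A ] ℬ A)
    × (∀ A → ℬ A → Elem A ↔ Carrier)
    × (∀ A B → ℬ A → ℬ B →
         ∃[ C ] (ℬ C × (∀ x → x ∈ C → (x ∈ A × x ∈ B))))

  IsIntersectionOfCopies : Subset Carrier → Set
  IsIntersectionOfCopies C =
    ∀ x → x ∈ C ⇔ (∀ A → IsCopy A → x ∈ A)

module _ {c ℓ₁ ℓ₂} (P : Poset c ℓ₁ ℓ₂) where
  open Poset P

  Compatible : Carrier → Carrier → Set (c Level.⊔ ℓ₂)
  Compatible p q = ∃[ r ] (r ≤ p × r ≤ q)

  Incompatible : Carrier → Carrier → Set (c Level.⊔ ℓ₂)
  Incompatible p q = ¬ Compatible p q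

  IsAtom : Carrier → Set (c Level.⊔ ℓ₂)
  IsAtom p = ∀ q r → q ≤ p → r ≤ p → Compatible q r

  Atomless : Set (c Level.⊔ ℓ₂)
  Atomless = ∀ p → ¬ IsAtom p

  Atomic : Set (c Level.⊔ ℓ₂)
  Atomic = ∀ p → ∃[ a ] (IsAtom a × a ≤ p)

  HasLargest : Set (c Level.⊔ ℓ₂)
  HasLargest = ∃[ m ] (∀ p → p ≤ m)

  Down : Carrier → Poset (c Level.⊔ ℓ₂) ℓ₁ ℓ₂
  Down p = record
    { Carrier = Σ Carrier (λ q → q ≤ p)
    ; _≈_ = λ a b → proj₁ a ≈ proj₁ b
    ; _≤_ = λ a b → proj₁ a ≤ proj₁ b
    ; isPartialOrder = record
      { isPreorder = record
        { isEquivalence = record { refl = Eq.refl ; sym = Eq.sym ; trans = Eq.trans }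
        ; reflexive = reflexive
        ; trans = trans
        }
      ; antisym = antisym
      }
    }

_≅ₚ_ : ∀ {c ℓ₁ ℓ₂ c' ℓ₁' ℓ₂'} → Poset c ℓ₁ ℓ₂ → Poset c' ℓ₁' ℓ₂' → Set _
P ≅ₚ Q = Σ (Poset.Carrier P → Poset.Carrier Q)
           (IsOrderIsomorphism (Poset._≈_ P) (Poset._≈_ Q) (Poset._≤_ P) (Poset._≤_ Q))

Homogeneous : ∀ {c ℓ₁ ℓ₂} → Poset c ℓ₁ ℓ₂ → Set _
Homogeneous P = HasLargest P × (∀ p → P ≅ₚ Down P p)

-- The isomorphism h : A ≅ 𝕏 of a copy A pulls every copy B back to the copy h⁻¹[B] ⊆ A,
-- and this is an order isomorphism ℙ(𝕏) ≅ (-∞, A]; so ℙ(𝕏) is homogeneous.  In a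
-- homogeneous poset one atom p makes (-∞, p], hence the whole poset, pairwise
-- compatible, which yields (b), (c) and the first half of (d).  If C = ⋂ ℙ(𝕏) is a copy
-- with h : C ≅ 𝕏, then C ⊆ h⁻¹[C], so X = h[C] ⊆ C; this needs no atomicity.
module Submission where

open import Defs
open import Data.Product using (Σ; ∃; ∃-syntax; _×_; _,_; proj₁; proj₂)
open import Data.Sum using (_⊎_; inj₁; inj₂)
open import Function.Bundles using (_⇔_; _↔_; Inverse; mk↔ₛ′; mk⇔; Equivalence)
open import Level using (0ℓ; _⊔_)
open import Axiom.ExcludedMiddle using (ExcludedMiddle)

open import Axiom.DoubleNegationElimination using (em⇒dne)
open import Data.Bool using (Bool; true; false; T)
open import Data.Bool.Properties using (T-irrelevant)
open import Data.Unit using (tt)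
open import Data.Vec using (Vec) renaming (map to vmap)
open import Data.Vec.Properties using (map-∘; map-cong)
open import Function using (_∘_; id)
open import Function.Construct.Composition using (_↔-∘_)
open import Function.Construct.Symmetry using (↔-sym)
open import Function.Properties.Equivalence using (⇔-setoid)
open import Relation.Nullary using (yes; no)
open import Relation.Binary.Bundles using (Poset)
open import Relation.Binary.Morphism.Structures using (IsOrderIsomorphism)
open import Relation.Binary.PropositionalEquality using (_≡_; refl; sym; trans; cong; subst)
import Relation.Binary.Reasoning.Setoid as SetoidReasoning

open Inverse using (to; from)

PairwiseCompatible : ∀ {c ℓ₁ ℓ₂} → Poset c ℓ₁ ℓ₂ → Set (c ⊔ ℓ₂)
PairwiseCompatible P = ∀ p q → Compatible P p q

module _ {c₁ ℓ₁ ℓ₂ c₂ ℓ₃ ℓ₄} {P : Poset c₁ ℓ₁ ℓ₂} {Q : Poset c₂ ℓ₃ ℓ₄} where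
  private
    module P = Poset P
    module Q = Poset Q

  Compatible-reflected : ((f , _) : P ≅ₚ Q) → ∀ {p q} →
                         Compatible Q (f p) (f q) → Compatible P p q
  Compatible-reflected (f , isIso) (r , r≤fp , r≤fq) =
    t , cancel (Q.trans ft≤r r≤fp) , cancel (Q.trans ft≤r r≤fq)
    where
    open IsOrderIsomorphism isIso
    t = proj₁ (surjective r)
    ft≤r = Q.reflexive (proj₂ (surjective r) P.Eq.refl)

module _ {c ℓ₁ ℓ₂} (P : Poset c ℓ₁ ℓ₂) where
  private
    module P = Poset P

  pairwiseCompatible⇒IsAtom : PairwiseCompatible P → ∀ p → IsAtom P p
  pairwiseCompatible⇒IsAtom compatible _ q r _ _ = compatible q r

  IsAtom⇒Down-pairwiseCompatible : ∀ {p} → IsAtom P p → PairwiseCompatible (Down P p)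
  IsAtom⇒Down-pairwiseCompatible atom (q , q≤p) (r , r≤p) with atom q r q≤p r≤p
  ... | s , s≤q , s≤r = (s , P.trans s≤q q≤p) , s≤q , s≤r

  module _ (homogeneous : Homogeneous P) where
    private
      top = proj₁ (proj₁ homogeneous)

    IsAtom⇒pairwiseCompatible : ∀ {p} → IsAtom P p → PairwiseCompatible P
    IsAtom⇒pairwiseCompatible {p} atom q r =
      Compatible-reflected {P = P} {Q = Down P p} P≅↓p
        (IsAtom⇒Down-pairwiseCompatible atom (proj₁ P≅↓p q) (proj₁ P≅↓p r))
      where P≅↓p = proj₂ homogeneous p

    atomic⇒pairwiseCompatible : Atomic P → PairwiseCompatible P
    atomic⇒pairwiseCompatible atomic =
      IsAtom⇒pairwiseCompatible (proj₁ (proj₂ (atomic top)))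

    module _ (em : ExcludedMiddle (c ⊔ ℓ₂)) where

      atomless⊎atomic : Atomless P ⊎ Atomic P
      atomless⊎atomic with em {∃ (IsAtom P)}
      ... | yes (_ , atom) =
        inj₂ λ q →
          q , pairwiseCompatible⇒IsAtom (IsAtom⇒pairwiseCompatible atom) q , P.refl
      ... | no noAtom      = inj₁ λ p atom → noAtom (p , atom)

      atomless⇔incompatible : Atomless P ⇔ (∃[ p ] ∃[ q ] Incompatible P p q)
      atomless⇔incompatible = mk⇔
        (λ atomless → dne λ allCompatible →
          atomless top λ q r _ _ → dne λ incompatible → allCompatible (q , r , incompatible))
        (λ (p , q , incompatible) _ atom → incompatible (IsAtom⇒pairwiseCompatible atom p q))
        where dne = em⇒dne em

_∧ᵈ_ : (b : Bool) → (T b → Bool) → Bool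
false ∧ᵈ k = false
true  ∧ᵈ k = k tt

T-∧ᵈ⁺ : ∀ b k (t : T b) → T (k t) → T (b ∧ᵈ k)
T-∧ᵈ⁺ true k tt u = u

T-∧ᵈ⁻ : ∀ b k → T (b ∧ᵈ k) → Σ (T b) (T ∘ k)
T-∧ᵈ⁻ true k u = tt , u

module Substructures (𝕏 : RelStr) where
  open RelStr 𝕏 renaming (Carrier to X)

  ⊆-trans : {U V W : Subset X} → U ⊆ V → V ⊆ W → U ⊆ W
  ⊆-trans U⊆V V⊆W x = V⊆W x ∘ U⊆V x

  Elem-≡ : ∀ {A : Subset X} {a b : Elem A} → proj₁ a ≡ proj₁ b → a ≡ b
  Elem-≡ {A} {x , p} {.x , q} refl = cong (x ,_) (T-irrelevant p q)

  Elem-full↔ : Elem {X} full ↔ X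
  Elem-full↔ = mk↔ₛ′ proj₁ (_, tt) (λ _ → refl) (λ _ → refl)

  Preserves : {A : Subset X} → (Elem A → X) → Set
  Preserves {A} f =
    ∀ i (v : Vec (Elem A) (arity i)) → rel i (vmap proj₁ v) ⇔ rel i (vmap f v)

  _≅_ : Subset X → Subset X → Set
  S ≅ T = Σ (Elem S ↔ Elem T) λ e → Preserves (proj₁ ∘ to e)

  Preserves-∘ : ∀ {S T} {g : Elem S → Elem T} {f : Elem T → X} →
                Preserves (proj₁ ∘ g) → Preserves f → Preserves (f ∘ g)
  Preserves-∘ {g = g} {f} preserves-g preserves-f i v = begin
    rel i (vmap proj₁ v)           ≈⟨ preserves-g i v ⟩
    rel i (vmap (proj₁ ∘ g) v)     ≡⟨ cong (rel i) (map-∘ proj₁ g v) ⟩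
    rel i (vmap proj₁ (vmap g v))  ≈⟨ preserves-f i (vmap g v) ⟩
    rel i (vmap f (vmap g v))      ≡⟨ cong (rel i) (map-∘ f g v) ⟨
    rel i (vmap (f ∘ g) v)         ∎
    where open SetoidReasoning (⇔-setoid 0ℓ)

  ≅-trans : ∀ {S T U} → S ≅ T → T ≅ U → S ≅ U
  ≅-trans (e , preserves-e) (f , preserves-f) =
    f ↔-∘ e , Preserves-∘ preserves-e preserves-f

  ≅-sym : ∀ {S T} → S ≅ T → T ≅ S
  ≅-sym (e , preserves-e) = ↔-sym e , λ i v → begin
    rel i (vmap proj₁ v)                          ≡⟨ cong (rel i) (map-cong proj₁-inverseˡ v) ⟨
    rel i (vmap (proj₁ ∘ to e ∘ from e) v)        ≡⟨ cong (rel i) (map-∘ (proj₁ ∘ to e) (from e) v) ⟩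
    rel i (vmap (proj₁ ∘ to e) (vmap (from e) v)) ≈⟨ preserves-e i (vmap (from e) v) ⟨
    rel i (vmap proj₁ (vmap (from e) v))          ≡⟨ cong (rel i) (map-∘ proj₁ (from e) v) ⟨
    rel i (vmap (proj₁ ∘ from e) v)               ∎
    where
    open SetoidReasoning (⇔-setoid 0ℓ)
    proj₁-inverseˡ : ∀ b → proj₁ (to e (from e b)) ≡ proj₁ b
    proj₁-inverseˡ b = cong proj₁ (Inverse.strictlyInverseˡ e b)

  IsCopy⇒≅full : ∀ {A} → IsCopy 𝕏 A → A ≅ full
  IsCopy⇒≅full (h , preserves-h) = ↔-sym Elem-full↔ ↔-∘ h , preserves-h

  ≅full⇒IsCopy : ∀ {A} → A ≅ full → IsCopy 𝕏 A
  ≅full⇒IsCopy (e , preserves-e) = Elem-full↔ ↔-∘ e , preserves-e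

  IsCopy-full : IsCopy 𝕏 full
  IsCopy-full = Elem-full↔ , λ _ _ → mk⇔ id id

  IsCopy-≅ : ∀ {S T} → S ≅ T → IsCopy 𝕏 T → IsCopy 𝕏 S
  IsCopy-≅ S≅T copy = ≅full⇒IsCopy (≅-trans S≅T (IsCopy⇒≅full copy))

  preimage : ∀ {S T} → Elem S ↔ Elem T → Subset X → Subset X
  preimage {S} e U x = S x ∧ᵈ λ s → U (proj₁ (to e (x , s)))

  module _ {S T : Subset X} (e : Elem S ↔ Elem T) where

    ∈-preimage⁺ : ∀ U {x} (s : x ∈ S) →
                  proj₁ (to e (x , s)) ∈ U → x ∈ preimage e U
    ∈-preimage⁺ U {x} = T-∧ᵈ⁺ (S x) _

    ∈-preimage⁻ : ∀ U {x} → x ∈ preimage e U →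
                  Σ (x ∈ S) λ s → proj₁ (to e (x , s)) ∈ U
    ∈-preimage⁻ U {x} = T-∧ᵈ⁻ (S x) _

    preimage⊆dom : ∀ U → preimage e U ⊆ S
    preimage⊆dom U x = proj₁ ∘ ∈-preimage⁻ U

    preimage-mono : ∀ {U V} → U ⊆ V → preimage e U ⊆ preimage e V
    preimage-mono {U} {V} U⊆V x x∈U with ∈-preimage⁻ U x∈U
    ... | s , u = ∈-preimage⁺ V s (U⊆V _ u)

    to∘from : ∀ {y} (t : y ∈ T) (s : proj₁ (from e (y , t)) ∈ S) →
              proj₁ (to e (proj₁ (from e (y , t)) , s)) ≡ y
    to∘from t s =
      cong proj₁ (trans (cong (to e) (Elem-≡ refl)) (Inverse.strictlyInverseˡ e (_ , t)))

  module _ {S T : Subset X} (e : Elem S ↔ Elem T) where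

    preimage-sym-preimage⊆ : ∀ U → preimage (↔-sym e) (preimage e U) ⊆ U
    preimage-sym-preimage⊆ U y y∈ with ∈-preimage⁻ (↔-sym e) (preimage e U) y∈
    ... | t , x∈ with ∈-preimage⁻ e U x∈
    ... | s , u = subst (_∈ U) (to∘from e t s) u

    ⊆-preimage-sym-preimage : ∀ {U} → U ⊆ T → U ⊆ preimage (↔-sym e) (preimage e U)
    ⊆-preimage-sym-preimage {U} U⊆T y u =
      ∈-preimage⁺ (↔-sym e) (preimage e U) t
        (∈-preimage⁺ e U s (subst (_∈ U) (sym (to∘from e t s)) u))
      where
      t = U⊆T y u
      s = proj₂ (from e (y , t))

    preimage-cancel : ∀ {U V} → U ⊆ T → preimage e U ⊆ preimage e V → U ⊆ V
    preimage-cancel {V = V} U⊆T pre-U⊆pre-V =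
      ⊆-trans (⊆-preimage-sym-preimage U⊆T)
        (⊆-trans (preimage-mono (↔-sym e) pre-U⊆pre-V) (preimage-sym-preimage⊆ V))

    dom⊆preimage⇒cod⊆ : ∀ {U} → S ⊆ preimage e U → T ⊆ U
    dom⊆preimage⇒cod⊆ {U} S⊆pre-U y t
      with ∈-preimage⁻ e U (S⊆pre-U _ (proj₂ (from e (y , t))))
    ... | s , u = subst (_∈ U) (to∘from e t s) u

  preimage-≅ : ∀ {S T U} ((e , _) : S ≅ T) → U ⊆ T → preimage e U ≅ U
  preimage-≅ {S} {T} {U} (e , preserves-e) U⊆T =
    mk↔ₛ′ restrict extend restrict∘extend extend∘restrict ,
    Preserves-∘ (λ _ _ → mk⇔ id id) preserves-e
    where
    inclusion : Elem (preimage e U) → Elem S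
    inclusion (x , x∈) = x , proj₁ (∈-preimage⁻ e U x∈)
    restrict : Elem (preimage e U) → Elem U
    restrict (x , x∈) = proj₁ (to e (inclusion (x , x∈))) , proj₂ (∈-preimage⁻ e U x∈)
    extend : Elem U → Elem (preimage e U)
    extend (y , u) = proj₁ (from e (y , t)) ,
                     ∈-preimage⁺ e U s (subst (_∈ U) (sym (to∘from e t s)) u)
      where
      t = U⊆T y u
      s = proj₂ (from e (y , t))
    restrict∘extend : ∀ b → restrict (extend b) ≡ b
    restrict∘extend (y , u) = Elem-≡ (to∘from e (U⊆T y u) _)
    extend∘restrict : ∀ a → extend (restrict a) ≡ a
    extend∘restrict (x , x∈) = Elem-≡ (to∘from (↔-sym e) _ _)

  IsCopy-preimage : ∀ {A B} ((e , _) : A ≅ full) →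
                    IsCopy 𝕏 B → IsCopy 𝕏 (preimage e B)
  IsCopy-preimage ι = IsCopy-≅ (preimage-≅ ι (λ _ _ → tt))

  module _ (p : Copy 𝕏) where
    private
      ι = IsCopy⇒≅full (proj₂ p)
      e = proj₁ ι
      cancel : ∀ {U V} → preimage e U ⊆ preimage e V → U ⊆ V
      cancel = preimage-cancel e (λ _ _ → tt)

    pullback : Copy 𝕏 → Poset.Carrier (Down (ℙ 𝕏) p)
    pullback (B , B-copy) = (preimage e B , IsCopy-preimage ι B-copy) , preimage⊆dom e B

    pullback-surjective : ∀ C → ∃ λ (B : Copy 𝕏) → ∀ {B' : Copy 𝕏} →
                          proj₁ B' ≐ proj₁ B → proj₁ (proj₁ (pullback B')) ≐ proj₁ (proj₁ C)
    pullback-surjective ((C , C-copy) , C⊆p) =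
      B , λ (B'⊆B , B⊆B') →
        ⊆-trans (preimage-mono e B'⊆B) (preimage-sym-preimage⊆ (↔-sym e) C) ,
        ⊆-trans (⊆-preimage-sym-preimage (↔-sym e) C⊆p) (preimage-mono e B⊆B')
      where
      B = preimage (↔-sym e) C , IsCopy-≅ (preimage-≅ (≅-sym ι) C⊆p) C-copy

    ℙ≅Down : ℙ 𝕏 ≅ₚ Down (ℙ 𝕏) p
    ℙ≅Down = pullback , record
      { isOrderMonomorphism = record
        { isOrderHomomorphism = record
          { cong = λ (B⊆B' , B'⊆B) → preimage-mono e B⊆B' , preimage-mono e B'⊆B
          ; mono = preimage-mono e
          }
        ; injective = λ (B⊆B' , B'⊆B) → cancel B⊆B' , cancel B'⊆B
        ; cancel = cancel
        }
      ; surjective = pullback-surjective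
      }

  ℙ-homogeneous : Homogeneous (ℙ 𝕏)
  ℙ-homogeneous = ((full , IsCopy-full) , λ _ _ _ → tt) , ℙ≅Down

  pairwiseCompatible⇒uniformFilterBase :
    PairwiseCompatible (ℙ 𝕏) → IsUniformFilterBase 𝕏 (IsCopy 𝕏)
  pairwiseCompatible⇒uniformFilterBase compatible =
    (full , IsCopy-full) , (λ _ → proj₁) , λ A B A-copy B-copy →
      let ((C , C-copy) , C⊆A , C⊆B) = compatible (A , A-copy) (B , B-copy)
      in C , C-copy , λ x x∈C → C⊆A x x∈C , C⊆B x x∈C

  copyIntersection⇒full : ∀ {C} →
                          IsCopy 𝕏 C → IsIntersectionOfCopies 𝕏 C → full ⊆ C
  copyIntersection⇒full {C} C-copy intersection =
    dom⊆preimage⇒cod⊆ (proj₁ ι) λ x x∈C →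
      Equivalence.to (intersection x) x∈C _ (IsCopy-preimage ι C-copy)
    where ι = IsCopy⇒≅full C-copy

  copyIntersection⇔onlyFull : (∃[ C ] (IsCopy 𝕏 C × IsIntersectionOfCopies 𝕏 C))
                              ⇔ (IsCopy 𝕏 full × (∀ A → IsCopy 𝕏 A → A ≐ full))
  copyIntersection⇔onlyFull = mk⇔
    (λ (C , C-copy , intersection) → IsCopy-full , λ A A-copy → (λ _ _ → tt) , λ x _ →
      Equivalence.to (intersection x) (copyIntersection⇒full C-copy intersection x tt) A A-copy)
    (λ (full-copy , onlyFull) →
      full , full-copy , λ x →
        mk⇔ (λ _ A A-copy → proj₂ (onlyFull A A-copy) x tt) (λ _ → tt))

theorem2p2 : ExcludedMiddle 0ℓ → (𝕏 : RelStr) →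
    Homogeneous (ℙ 𝕏)
  × (Atomless (ℙ 𝕏) ⊎ Atomic (ℙ 𝕏))
  × (Atomless (ℙ 𝕏) ⇔ (∃[ p ] ∃[ q ] Incompatible (ℙ 𝕏) p q))
  × (Atomic (ℙ 𝕏) →
        (∀ p → IsAtom (ℙ 𝕏) p)
      × IsUniformFilterBase 𝕏 (IsCopy 𝕏)
      × ((∃[ C ] (IsCopy 𝕏 C × IsIntersectionOfCopies 𝕏 C))
          ⇔ (IsCopy 𝕏 full × (∀ A → IsCopy 𝕏 A → A ≐ full))))
theorem2p2 em 𝕏 =
    ℙ-homogeneous
  , atomless⊎atomic (ℙ 𝕏) ℙ-homogeneous em
  , atomless⇔incompatible (ℙ 𝕏) ℙ-homogeneous em
  , λ atomic →
      let compatible = atomic⇒pairwiseCompatible (ℙ 𝕏) ℙ-homogeneous atomic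
      in pairwiseCompatible⇒IsAtom (ℙ 𝕏) compatible
       , pairwiseCompatible⇒uniformFilterBase compatible
       , copyIntersection⇔onlyFull
  where open Substructures 𝕏
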